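{- Let $T_h$ be the perfect binary tree of depth $h$ (every non-leaf vertex has two children and there are $2^h$ leaves, all at distance $h$ from the root). Then $$\sqrt{\frac{h}{\log_2 h}} \le \pi_{per}(T_h) \le h+1.$$
   Context: For a graph $G$ and a vertex coloring $c:V(G)\to\mathcal{C}$, two vertex sets $V_1,V_2$ have the same coloring if $|c^{ -1}(a)\cap V_1|=|c^{ -1}(a)\cap V_2|$ for every color $a$. An anagram is a path $v_1v_2\dots v_{2k}$ ($k\ge1$) in $G$ such that $\{v_1,\dots,v_k\}$ and $\{v_{k+1},\dots,v_{2k}\}$ have the same coloring. A coloring is anagram-free if it contains no anagram, and $\pi_{per}(G)$ is the minimum number of colors in an anagram-free coloring of $G$. -}

module Defs where

open import Data.Nat using (ℕ; zero; suc; _+_; _*_; _∸_; _^_; _≤_)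
open import Data.Fin using (Fin; toℕ)
open import Data.Fin.Properties using (_≟_)
open import Data.List using (List; []; _∷_; length; take; drop; filter)
open import Data.List.Relation.Unary.Unique.Propositional using (Unique)
open import Data.Product using (Σ; _×_; ∃-syntax)
open import Data.Sum using (_⊎_)
open import Data.Unit using (⊤)
open import Relation.Binary.PropositionalEquality using (_≡_)
open import Relation.Nullary using (¬_)
open import Level using (0ℓ; suc)

record Graph : Set₁ where
  field
    n   : ℕ
    Adj : Fin n → Fin n → Set

open Graph public

Walk : (G : Graph) → List (Fin (n G)) → Set
Walk G []           = ⊤
Walk G (x ∷ [])     = ⊤
Walk G (x ∷ y ∷ xs) = Adj G x y × Walk G (y ∷ xs)

IsPath : (G : Graph) → List (Fin (n G)) → Set
IsPath G xs = Walk G xs × Unique xs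

countColour : ∀ {m k} → (Fin m → Fin k) → Fin k → List (Fin m) → ℕ
countColour c a xs = length (filter (λ v → c v ≟ a) xs)

SameColouring : ∀ {m k} → (Fin m → Fin k) → List (Fin m) → List (Fin m) → Set
SameColouring {k = k} c xs ys = ∀ (a : Fin k) → countColour c a xs ≡ countColour c a ys

IsAnagram : ∀ {k} (G : Graph) → (Fin (n G) → Fin k) → List (Fin (n G)) → Set
IsAnagram G c p =
  ∃[ j ] (1 ≤ j × length p ≡ j + j × IsPath G p × SameColouring c (take j p) (drop j p))

AnagramFree : ∀ {k} (G : Graph) → (Fin (n G) → Fin k) → Set
AnagramFree G c = ∀ p → ¬ IsAnagram G c p

-- Perfect binary tree of depth h, in heap numbering: vertices 0 .. 2^(h+1) - 2,
-- vertex i has children 2i+1 and 2i+2.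
Child : ∀ {m} → Fin m → Fin m → Set
Child i j = toℕ j ≡ 2 * toℕ i + 1 ⊎ toℕ j ≡ 2 * toℕ i + 2

T : ℕ → Graph
T h = record { n = 2 ^ (h + 1) ∸ 1 ; Adj = λ i j → Child i j ⊎ Child j i }

-- Upper bound: colour every vertex by its depth. A path in a tree climbs and then descends,
-- so its shallowest vertex is the only vertex of its colour, and a colour that occurs an odd
-- number of times cannot be shared equally by the two halves of an anagram.
--
-- Lower bound: let c be anagram-free with k colours. Adjacent vertices get distinct colours,
-- so along a root-to-leaf branch each colour occupies at most ⌈t/2⌉ of the first t vertices.
-- Record for every colour a its deepest occurrence s on the branch, the direction taken at s,
-- and the colour counts of the branch above s. If two branches first part at depth e, let a
-- be the colour of their fork vertex. Equal records for a give either the same direction at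
-- depth e, or an anagram: the path that climbs the first branch from depth s back to the fork
-- and descends the second one. So the 2^h branches have distinct records, and
-- 2^h ≤ (1 + 2(1 + ⌈h/2⌉)^k)^k. A path on four vertices forces k ≥ 3, and then the right-hand
-- side is at most h^(k²) unless h ≤ k², when 2^h ≤ h^(k²) holds anyway.
module Submission where

open import Defs
open import Data.Empty using (⊥-elim)
open import Data.Fin using (Fin; zero; suc; toℕ; fromℕ<; combine; funToFin; finToFun)
open import Data.Fin.Properties
  using (_≟_; ¬Fin0; toℕ-fromℕ<; fromℕ<-toℕ; toℕ-injective; toℕ<n; combine-injective;
         finToFun-funToFin; funToFin-finToFin; injective⇒≤)
  renaming (suc-injective to Fin-suc-injective)
open import Data.List
  using (List; []; _∷_; [_]; _++_; length; filter; map; take; drop; applyUpTo; applyDownFrom)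
open import Data.List.Membership.Propositional using (_∈_)
open import Data.List.Membership.Propositional.Properties using (∈-applyUpTo⁻; ∈-applyDownFrom⁻)
open import Data.List.Properties
  using (length-++; length-map; length-filter; length-applyUpTo; length-applyDownFrom; filter-++;
         filter-accept; filter-reject; filter-none; reverse-applyUpTo; applyUpTo-∷ʳ; take++drop≡id)
open import Data.List.Relation.Binary.Permutation.Propositional using (_↭_)
open import Data.List.Relation.Binary.Permutation.Propositional.Properties
  using (↭-length; filter-↭; ↭-reverse)
open import Data.List.Relation.Unary.All as All using (All; []; _∷_)
open import Data.List.Relation.Unary.AllPairs using ([]; _∷_)
open import Data.List.Relation.Unary.Unique.Propositional using (Unique)
open import Data.List.Relation.Unary.Unique.Propositional.Properties
  using (applyUpTo⁺₁; applyDownFrom⁺₁; ++⁺)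
open import Data.Maybe using (Maybe; just; nothing)
open import Data.Nat
  using (ℕ; zero; suc; NonZero; >-nonZero; _+_; _*_; _∸_; _^_; _≤_; _<_; _≤?_; _<?_;
         z≤n; s≤s; s≤s⁻¹; ⌊_/2⌋; ⌈_/2⌉)
open import Data.Nat.DivMod using (_mod_; m<n⇒m%n≡m)
open import Data.Nat.Logarithm using (⌊log₂_⌋; ⌊log₂⌋-mono-≤; ⌊log₂⌊n/2⌋⌋≡⌊log₂n⌋∸1; ⌊log₂[2^n]⌋≡n)
open import Data.Nat.Properties hiding (_≟_)
open import Data.Nat.Tactic.RingSolver using (solve-∀)
open import Algebra.Properties.CommutativeMonoid.Sum +-0-commutativeMonoid
  using (sum-syntax; ∑-distrib-+; sum-cong-≗; sum-replicate-zero)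
open import Algebra.Properties.CommutativeSemigroup +-commutativeSemigroup using (xy∙z≈xz∙y)
open import Algebra.Properties.CommutativeSemigroup *-commutativeSemigroup
  using () renaming (x∙yz≈y∙xz to *-left-comm)
open import Data.Product using (Σ; _×_; _,_; proj₁; proj₂; ∃-syntax)
open import Data.Sum using (_⊎_; inj₁; inj₂)
open import Data.Unit using (tt)
open import Function using (id; _∘_; _$_)
open import Relation.Binary.PropositionalEquality hiding ([_])
open import Relation.Nullary using (¬_; yes; no; contradiction)
open import Relation.Nullary.Decidable using (decidable-stable)
open import Relation.Unary using (Decidable)

private
  variable
    m k : ℕ

applyUpTo-++ : ∀ {A : Set} (F : ℕ → A) s l →
  applyUpTo F (s + l) ≡ applyUpTo F s ++ applyUpTo (λ i → F (s + i)) l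
applyUpTo-++ F zero l = refl
applyUpTo-++ F (suc s) l = cong (F 0 ∷_) (applyUpTo-++ (λ i → F (suc i)) s l)

applyUpTo-cong : ∀ {A : Set} {F G : ℕ → A} t → (∀ i → i < t → F i ≡ G i) →
  applyUpTo F t ≡ applyUpTo G t
applyUpTo-cong zero _ = refl
applyUpTo-cong (suc t) F≡G =
  cong₂ _∷_ (F≡G 0 (s≤s z≤n)) (applyUpTo-cong t (λ i i<t → F≡G (suc i) (s≤s i<t)))

take-length-++ : ∀ {A : Set} (xs ys : List A) → take (length xs) (xs ++ ys) ≡ xs
take-length-++ [] ys = refl
take-length-++ (x ∷ xs) ys = cong (x ∷_) (take-length-++ xs ys)

drop-length-++ : ∀ {A : Set} (xs ys : List A) → drop (length xs) (xs ++ ys) ≡ ys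
drop-length-++ [] ys = refl
drop-length-++ (x ∷ xs) ys = drop-length-++ xs ys

countColour-++ : (c : Fin m → Fin k) → ∀ a xs ys →
  countColour c a (xs ++ ys) ≡ countColour c a xs + countColour c a ys
countColour-++ c a xs ys = trans (cong length (filter-++ _ xs ys)) (length-++ (filter _ xs))

countColour-↭ : (c : Fin m → Fin k) → ∀ a {xs ys} → xs ↭ ys → countColour c a xs ≡ countColour c a ys
countColour-↭ c a xs↭ys = ↭-length (filter-↭ _ xs↭ys)

countColour-applyDownFrom : (c : Fin m → Fin k) → ∀ a F n →
  countColour c a (applyDownFrom F n) ≡ countColour c a (applyUpTo F n)
countColour-applyDownFrom c a F n = trans (cong (countColour c a) (sym (reverse-applyUpTo F n)))
                                          (countColour-↭ c a (↭-reverse (applyUpTo F n)))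

countColour-[]≤1 : (c : Fin m → Fin k) → ∀ a x → countColour c a [ x ] ≤ 1
countColour-[]≤1 c a x = length-filter (λ v → c v ≟ a) [ x ]

countColour-∷-≡ : (c : Fin m → Fin k) → ∀ {a x} xs → c x ≡ a →
  countColour c a (x ∷ xs) ≡ suc (countColour c a xs)
countColour-∷-≡ c {a} xs c[x]≡a = cong length (filter-accept (λ v → c v ≟ a) {xs = xs} c[x]≡a)

countColour-∷-≢ : (c : Fin m → Fin k) → ∀ {a x} xs → c x ≢ a →
  countColour c a (x ∷ xs) ≡ countColour c a xs
countColour-∷-≢ c {a} xs c[x]≢a = cong length (filter-reject (λ v → c v ≟ a) {xs = xs} c[x]≢a)

countColour-none : (c : Fin m → Fin k) → ∀ {a xs} → All (λ v → c v ≢ a) xs → countColour c a xs ≡ 0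
countColour-none c {a} none = cong length (filter-none (λ v → c v ≟ a) none)

countColour-map : (c : Fin m → Fin k) → ∀ a xs → countColour c a xs ≡ countColour id a (map c xs)
countColour-map c a [] = refl
countColour-map c a (x ∷ xs) with c x ≟ a
... | yes _ = cong suc (countColour-map c a xs)
... | no _ = countColour-map c a xs

sameColouring-map : (c : Fin m → Fin k) → ∀ {xs ys} → map c xs ≡ map c ys → SameColouring c xs ys
sameColouring-map c {xs} {ys} eq a =
  trans (countColour-map c a xs) (trans (cong (countColour id a) eq) (sym (countColour-map c a ys)))

∑-countColour-[] : (b : Fin k) → ∑[ a < k ] countColour id a [ b ] ≡ 1
∑-countColour-[] {suc k} zero = cong suc (sum-replicate-zero k)
∑-countColour-[] {suc k} (suc b) = trans (sum-cong-≗ shift) (∑-countColour-[] b)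
  where
  shift : ∀ a → countColour id (suc a) [ suc b ] ≡ countColour id a [ b ]
  shift a with b ≟ a
  ... | yes _ = refl
  ... | no _ = refl

∑-countColour : (c : Fin m → Fin k) → ∀ xs → ∑[ a < k ] countColour c a xs ≡ length xs
∑-countColour {k = k} c xs =
  trans (sum-cong-≗ (λ a → countColour-map c a xs)) (trans (∑-counts (map c xs)) (length-map c xs))
  where
  open ≡-Reasoning
  ∑-counts : ∀ bs → ∑[ a < k ] countColour id a bs ≡ length bs
  ∑-counts [] = sum-replicate-zero k
  ∑-counts (b ∷ bs) = begin
    ∑[ a < k ] countColour id a (b ∷ bs)
      ≡⟨ sum-cong-≗ (λ a → countColour-++ id a [ b ] bs) ⟩
    ∑[ a < k ] (countColour id a [ b ] + countColour id a bs)
      ≡⟨ ∑-distrib-+ (λ a → countColour id a [ b ]) (λ a → countColour id a bs) ⟩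
    ∑[ a < k ] countColour id a [ b ] + ∑[ a < k ] countColour id a bs
      ≡⟨ cong₂ _+_ (∑-countColour-[] b) (∑-counts bs) ⟩
    suc (length bs)
      ∎

sameColouring⇒≡length : (c : Fin m → Fin k) → ∀ {xs ys} → SameColouring c xs ys → length xs ≡ length ys
sameColouring⇒≡length c {xs} {ys} same =
  trans (sym (∑-countColour c xs)) (trans (sum-cong-≗ same) (∑-countColour c ys))

countColour-properPair : (c : Fin m → Fin k) → ∀ a {x y} → c x ≢ c y → countColour c a (x ∷ y ∷ []) ≤ 1
countColour-properPair c a {x} {y} c[x]≢c[y] =
  subst (_≤ 1) (sym (countColour-++ c a [ x ] [ y ])) separate
  where
  separate : countColour c a [ x ] + countColour c a [ y ] ≤ 1
  separate with c x ≟ a | c y ≟ a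
  ... | yes c[x]≡a | yes c[y]≡a = contradiction (trans c[x]≡a (sym c[y]≡a)) c[x]≢c[y]
  ... | yes _ | no _ = ≤-refl
  ... | no _ | yes _ = ≤-refl
  ... | no _ | no _ = z≤n

countColour-alternating : (c : Fin m → Fin k) (F : ℕ → Fin m) → ∀ t →
  (∀ i → suc i < t → c (F i) ≢ c (F (suc i))) → ∀ a → countColour c a (applyUpTo F t) ≤ ⌈ t /2⌉
countColour-alternating c F zero _ a = z≤n
countColour-alternating c F (suc zero) _ a = countColour-[]≤1 c a (F 0)
countColour-alternating c F (suc (suc t)) proper a = begin
  countColour c a (F 0 ∷ F 1 ∷ rest)                      ≡⟨ countColour-++ c a (F 0 ∷ F 1 ∷ []) rest ⟩
  countColour c a (F 0 ∷ F 1 ∷ []) + countColour c a rest ≤⟨ +-mono-≤ firstPair restBound ⟩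
  suc ⌈ t /2⌉                                             ∎
  where
  open ≤-Reasoning
  rest = applyUpTo (λ i → F (2 + i)) t
  firstPair = countColour-properPair c a (proper 0 (s≤s (s≤s z≤n)))
  restBound = countColour-alternating c (λ i → F (2 + i)) t (λ i i<t → proper (2 + i) (s≤s (s≤s i<t))) a

-- Both halves count the prefix colours at depth e + L minus those at depth e: the climb trades
-- F e for F (e + L), which has the same colour.
sameColouring-fork : (c : Fin m → Fin k) (F G : ℕ → Fin m) → ∀ e L →
  (∀ i → i < e → F i ≡ G i) → c (F (e + L)) ≡ c (F e) →
  SameColouring c (applyUpTo F (e + L)) (applyUpTo G (e + L)) →
  SameColouring c (applyDownFrom (λ i → F (suc e + i)) L) (applyUpTo (λ i → G (e + i)) L)
sameColouring-fork {m = m} c F G e L agree repeat same a = +-cancelˡ-≡ (P F e + δ) _ _ (begin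
  P F e + δ + countColour c a climb
    ≡⟨ cong₂ _+_ (sym (P-snoc F e)) (countColour-applyDownFrom c a _ L) ⟩
  P F (suc e) + countColour c a (applyUpTo (λ i → F (suc e + i)) L)
    ≡⟨ sym (P-split F (suc e) L) ⟩
  P F (suc e + L)
    ≡⟨ P-snoc F (e + L) ⟩
  P F (e + L) + countColour c a [ F (e + L) ]
    ≡⟨ cong₂ _+_ (same a) (sameColouring-map c (cong [_] repeat) a) ⟩
  P G (e + L) + δ
    ≡⟨ cong (_+ δ) (P-split G e L) ⟩
  P G e + countColour c a descent + δ
    ≡⟨ cong (λ p → countColour c a p + countColour c a descent + δ) (applyUpTo-cong e agree) ⟨
  P F e + countColour c a descent + δ
    ≡⟨ xy∙z≈xz∙y (P F e) _ δ ⟩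
  P F e + δ + countColour c a descent
    ∎)
  where
  open ≡-Reasoning
  climb = applyDownFrom (λ i → F (suc e + i)) L
  descent = applyUpTo (λ i → G (e + i)) L
  P : (ℕ → Fin m) → ℕ → ℕ
  P H t = countColour c a (applyUpTo H t)
  δ = countColour c a [ F e ]
  P-snoc : ∀ H t → P H (suc t) ≡ P H t + countColour c a [ H t ]
  P-snoc H t = trans (cong (countColour c a) (sym (applyUpTo-∷ʳ H t)))
                     (countColour-++ c a (applyUpTo H t) [ H t ])
  P-split : ∀ H s l → P H (s + l) ≡ P H s + countColour c a (applyUpTo (λ i → H (s + i)) l)
  P-split H s l = trans (cong (countColour c a) (applyUpTo-++ H s l))
                        (countColour-++ c a (applyUpTo H s) _)

-- Anagrams in arbitrary graphs

Fin1-≡ : (u v : Fin 1) → u ≡ v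
Fin1-≡ zero zero = refl

Fin2-≢⇒≡ : {u v w : Fin 2} → u ≢ v → v ≢ w → u ≡ w
Fin2-≢⇒≡ {zero} {suc zero} {zero} _ _ = refl
Fin2-≢⇒≡ {suc zero} {zero} {suc zero} _ _ = refl
Fin2-≢⇒≡ {zero} {zero} u≢v _ = contradiction refl u≢v
Fin2-≢⇒≡ {suc zero} {suc zero} u≢v _ = contradiction refl u≢v
Fin2-≢⇒≡ {_} {zero} {zero} _ v≢w = contradiction refl v≢w
Fin2-≢⇒≡ {_} {suc zero} {suc zero} _ v≢w = contradiction refl v≢w

n+n≢1 : ∀ n → n + n ≢ 1
n+n≢1 n n+n≡1 = even≢odd n 0 (trans (cong (n +_) (+-identityʳ n)) n+n≡1)

module _ (G : Graph) where

  Walk-applyUpTo : (F : ℕ → Fin (n G)) → ∀ t → (∀ i → suc i < t → Adj G (F i) (F (suc i))) →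
    Walk G (applyUpTo F t)
  Walk-applyUpTo F zero _ = tt
  Walk-applyUpTo F (suc zero) _ = tt
  Walk-applyUpTo F (suc (suc t)) adj =
    adj 0 (s≤s (s≤s z≤n)) , Walk-applyUpTo (λ i → F (suc i)) (suc t) (λ i i<t → adj (suc i) (s≤s i<t))

  Walk-applyDownFrom-++ : (F : ℕ → Fin (n G)) → ∀ t {ys} → (∀ i → i < t → Adj G (F (suc i)) (F i)) →
    Walk G (F 0 ∷ ys) → Walk G (applyDownFrom F (suc t) ++ ys)
  Walk-applyDownFrom-++ F zero _ walk = walk
  Walk-applyDownFrom-++ F (suc t) adj walk =
    adj t ≤-refl , Walk-applyDownFrom-++ F t (λ i i<t → adj i (m<n⇒m<1+n i<t)) walk

  module _ {k} (c : Fin (n G) → Fin k) where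

    anagram-++ : ∀ {xs ys} → IsPath G (xs ++ ys) → length xs ≡ length ys → 1 ≤ length xs →
      SameColouring c xs ys → IsAnagram G c (xs ++ ys)
    anagram-++ {xs} {ys} path |xs|≡|ys| nonempty same =
      length xs , nonempty , trans (length-++ xs) (cong (length xs +_) (sym |xs|≡|ys|)) , path ,
      subst₂ (SameColouring c) (sym (take-length-++ xs ys)) (sym (drop-length-++ xs ys)) same

    colourOnce⇒anagramFree : (∀ x r → IsPath G (x ∷ r) → ∃[ a ] countColour c a (x ∷ r) ≡ 1) →
      AnagramFree G c
    colourOnce⇒anagramFree once [] (suc j , _ , () , _)
    colourOnce⇒anagramFree once (x ∷ r) (j , _ , _ , path , same) with a , count≡1 ← once x r path =
      n+n≢1 (countColour c a firstHalf) (begin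
        countColour c a firstHalf + countColour c a firstHalf ≡⟨ cong (countColour c a firstHalf +_) (same a) ⟩
        countColour c a firstHalf + countColour c a secondHalf ≡⟨ countColour-++ c a firstHalf secondHalf ⟨
        countColour c a (firstHalf ++ secondHalf)              ≡⟨ cong (countColour c a) (take++drop≡id j (x ∷ r)) ⟩
        countColour c a (x ∷ r)                                ≡⟨ count≡1 ⟩
        1                                                      ∎)
      where
      open ≡-Reasoning
      firstHalf = take j (x ∷ r)
      secondHalf = drop j (x ∷ r)

    anagramFree⇒proper : AnagramFree G c → ∀ {x y} → Adj G x y → x ≢ y → c x ≢ c y
    anagramFree⇒proper anagramFree {x} {y} adj x≢y c[x]≡c[y] =
      anagramFree (x ∷ y ∷ [])
        (anagram-++ {x ∷ []} {y ∷ []} ((adj , tt) , (x≢y ∷ []) ∷ [] ∷ []) refl ≤-refl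
          (sameColouring-map c (cong [_] c[x]≡c[y])))

  anagramFree⇒3≤colours : ∀ {k} (c : Fin (n G) → Fin k) → AnagramFree G c →
    ∀ {w x y z} → IsPath G (w ∷ x ∷ y ∷ z ∷ []) → 3 ≤ k
  anagramFree⇒3≤colours {zero} c _ {w} _ = ⊥-elim (¬Fin0 (c w))
  anagramFree⇒3≤colours {1} c anagramFree {w} {x} ((wx , _) , (w≢x ∷ _) ∷ _) =
    contradiction (Fin1-≡ (c w) (c x)) (anagramFree⇒proper c anagramFree wx w≢x)
  anagramFree⇒3≤colours {2} c anagramFree {w} {x} {y} {z}
    path@((wx , xy , yz , _) , (w≢x ∷ _) ∷ (x≢y ∷ _) ∷ (y≢z ∷ _) ∷ _) =
    ⊥-elim $ anagramFree _ $ anagram-++ c {w ∷ x ∷ []} {y ∷ z ∷ []} path refl (s≤s z≤n) $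
      sameColouring-map c (cong₂ (λ u v → u ∷ v ∷ [])
        (Fin2-≢⇒≡ (proper wx w≢x) (proper xy x≢y)) (Fin2-≢⇒≡ (proper xy x≢y) (proper yz y≢z)))
    where
    proper = anagramFree⇒proper c anagramFree
  anagramFree⇒3≤colours {suc (suc (suc k))} _ _ _ = s≤s (s≤s (s≤s z≤n))

-- Level colourings of trees

module _ {m k} (Edge : Fin m → Fin m → Set) (c : Fin m → Fin k)
  (level-edge : ∀ {x y} → Edge x y → toℕ (c y) ≡ suc (toℕ (c x)))
  (parent-unique : ∀ {x x′ y} → Edge x y → Edge x′ y → x ≡ x′) where

  private
    tree : Graph
    tree = record { n = m ; Adj = λ x y → Edge x y ⊎ Edge y x }

    level-< : ∀ {x y} → Edge x y → toℕ (c x) < toℕ (c y)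
    level-< xy = ≤-reflexive (sym (level-edge xy))

    -- A path never steps down to a child and then up again, as that would revisit the parent.
    below-after-descent : ∀ {x y} r → Edge x y → Walk tree (y ∷ r) → Unique (x ∷ y ∷ r) →
      All (λ v → toℕ (c x) < toℕ (c v)) (y ∷ r)
    below-after-descent [] xy _ _ = level-< xy ∷ []
    below-after-descent (z ∷ r) xy (inj₁ yz , walk) (_ ∷ unique) =
      level-< xy ∷ All.map (<-trans (level-< xy)) (below-after-descent r yz walk unique)
    below-after-descent (z ∷ r) xy (inj₂ zy , _) ((_ ∷ x≢z ∷ _) ∷ _) =
      contradiction (parent-unique xy zy) x≢z

    colourOnce : ∀ x r → IsPath tree (x ∷ r) → ∃[ a ] (countColour c a (x ∷ r) ≡ 1 × toℕ a ≤ toℕ (c x))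
    colourOnce x [] _ = c x , countColour-∷-≡ c [] refl , ≤-refl
    colourOnce x (y ∷ r) ((inj₁ xy , walk) , unique) =
      c x ,
      trans (countColour-∷-≡ c (y ∷ r) refl)
            (cong suc (countColour-none c (All.map ≢c[x] (below-after-descent r xy walk unique)))) ,
      ≤-refl
      where
      ≢c[x] : ∀ {v} → toℕ (c x) < toℕ (c v) → c v ≢ c x
      ≢c[x] lt eq = <⇒≢ lt (cong toℕ (sym eq))
    colourOnce x (y ∷ r) ((inj₂ yx , walk) , _ ∷ unique) with a , once , a≤y ← colourOnce y r (walk , unique) =
      a , trans (countColour-∷-≢ c (y ∷ r) c[x]≢a) once , <⇒≤ a<x
      where
      a<x : toℕ a < toℕ (c x)
      a<x = ≤-<-trans a≤y (level-< yx)
      c[x]≢a : c x ≢ a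
      c[x]≢a eq = <⇒≢ a<x (cong toℕ (sym eq))

  levelColouring-anagramFree : AnagramFree tree c
  levelColouring-anagramFree = colourOnce⇒anagramFree tree c once
    where
    once : ∀ x r → IsPath tree (x ∷ r) → ∃[ a ] countColour c a (x ∷ r) ≡ 1
    once x r path with a , count≡1 , _ ← colourOnce x r path = a , count≡1

-- Heap numbering

child : ℕ → Fin 2 → ℕ
child x zero = 2 * x + 1
child x (suc zero) = 2 * x + 2

node : (ℕ → Fin 2) → ℕ → ℕ
node f zero = 0
node f (suc t) = child (node f t) (f t)

depth : ℕ → ℕ
depth x = ⌊log₂ suc x ⌋

⌊1+n+n/2⌋≡n : ∀ n → ⌊ suc (n + n) /2⌋ ≡ n
⌊1+n+n/2⌋≡n n = +-cancelˡ-≡ n _ _ (begin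
  n + ⌈ n + n /2⌉           ≡⟨ cong (_+ ⌈ n + n /2⌉) (n≡⌊n+n/2⌋ n) ⟩
  ⌊ n + n /2⌋ + ⌈ n + n /2⌉ ≡⟨ ⌊n/2⌋+⌈n/2⌉≡n (n + n) ⟩
  n + n                     ∎)
  where open ≡-Reasoning

⌊1+child/2⌋≡1+x : ∀ x d → ⌊ suc (child x d) /2⌋ ≡ suc x
⌊1+child/2⌋≡1+x x zero = trans (cong ⌊_/2⌋ (rearrange x)) (sym (n≡⌊n+n/2⌋ (suc x)))
  where
  rearrange : ∀ x → 1 + (2 * x + 1) ≡ (1 + x) + (1 + x)
  rearrange = solve-∀
⌊1+child/2⌋≡1+x x (suc zero) = trans (cong ⌊_/2⌋ (rearrange x)) (⌊1+n+n/2⌋≡n (suc x))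
  where
  rearrange : ∀ x → 1 + (2 * x + 2) ≡ 1 + ((1 + x) + (1 + x))
  rearrange = solve-∀

child-injective : ∀ {x y d d′} → child x d ≡ child y d′ → x ≡ y × d ≡ d′
child-injective {x} {y} {d} {d′} eq
  with refl ← suc-injective (trans (sym (⌊1+child/2⌋≡1+x x d))
                                   (trans (cong (⌊_/2⌋ ∘ suc) eq) (⌊1+child/2⌋≡1+x y d′)))
  = refl , sameDirection d d′ eq
  where
  sameDirection : ∀ d d′ → child x d ≡ child x d′ → d ≡ d′
  sameDirection zero zero _ = refl
  sameDirection (suc zero) (suc zero) _ = refl
  sameDirection zero (suc zero) eq = contradiction (+-cancelˡ-≡ (2 * x) 1 2 eq) λ ()
  sameDirection (suc zero) zero eq = contradiction (+-cancelˡ-≡ (2 * x) 2 1 eq) λ ()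

depth-child : ∀ x d → depth (child x d) ≡ suc (depth x)
depth-child x d = begin
  ⌊log₂ y ⌋           ≡⟨ m+[n∸m]≡n 1≤⌊log₂y⌋ ⟨
  suc (⌊log₂ y ⌋ ∸ 1) ≡⟨ cong suc (⌊log₂⌊n/2⌋⌋≡⌊log₂n⌋∸1 y) ⟨
  suc ⌊log₂ ⌊ y /2⌋ ⌋ ≡⟨ cong (λ p → suc ⌊log₂ p ⌋) (⌊1+child/2⌋≡1+x x d) ⟩
  suc (depth x)       ∎
  where
  open ≡-Reasoning
  y = suc (child x d)
  1≤child : ∀ d → 1 ≤ child x d
  1≤child zero = m≤n+m 1 (2 * x)
  1≤child (suc zero) = ≤-trans (n≤1+n 1) (m≤n+m 2 (2 * x))
  1≤⌊log₂y⌋ : 1 ≤ ⌊log₂ y ⌋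
  1≤⌊log₂y⌋ = subst (_≤ ⌊log₂ y ⌋) (⌊log₂[2^n]⌋≡n 1) (⌊log₂⌋-mono-≤ (s≤s (1≤child d)))

n<2m⇒⌊n/2⌋<m : ∀ {n m} → n < 2 * m → ⌊ n /2⌋ < m
n<2m⇒⌊n/2⌋<m {n} {m} n<2m = ≰⇒> λ m≤⌊n/2⌋ → <⇒≱ n<2m (begin
  2 * m             ≡⟨ cong (m +_) (+-identityʳ m) ⟩
  m + m             ≤⟨ +-mono-≤ m≤⌊n/2⌋ m≤⌊n/2⌋ ⟩
  ⌊ n /2⌋ + ⌊ n /2⌋ ≤⟨ +-monoʳ-≤ ⌊ n /2⌋ (⌊n/2⌋≤⌈n/2⌉ n) ⟩
  ⌊ n /2⌋ + ⌈ n /2⌉ ≡⟨ ⌊n/2⌋+⌈n/2⌉≡n n ⟩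
  n                 ∎)
  where open ≤-Reasoning

n<2^[1+m]⇒⌊log₂n⌋≤m : ∀ m {n} → n < 2 ^ suc m → ⌊log₂ n ⌋ ≤ m
n<2^[1+m]⇒⌊log₂n⌋≤m zero {n} n<2 = subst (⌊log₂ n ⌋ ≤_) (⌊log₂[2^n]⌋≡n 0) (⌊log₂⌋-mono-≤ (s≤s⁻¹ n<2))
n<2^[1+m]⇒⌊log₂n⌋≤m (suc m) {n} n<2^[2+m] = begin
  ⌊log₂ n ⌋           ≤⟨ m≤n+m∸n ⌊log₂ n ⌋ 1 ⟩
  suc (⌊log₂ n ⌋ ∸ 1) ≡⟨ cong suc (⌊log₂⌊n/2⌋⌋≡⌊log₂n⌋∸1 n) ⟨
  suc ⌊log₂ ⌊ n /2⌋ ⌋ ≤⟨ s≤s (n<2^[1+m]⇒⌊log₂n⌋≤m m (n<2m⇒⌊n/2⌋<m n<2^[2+m])) ⟩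
  suc m               ∎
  where open ≤-Reasoning

depth-node : ∀ f t → depth (node f t) ≡ t
depth-node f zero = ⌊log₂[2^n]⌋≡n 0
depth-node f (suc t) = trans (depth-child (node f t) (f t)) (cong suc (depth-node f t))

node-injective : ∀ f g {i j} → node f i ≡ node g j → i ≡ j × (∀ u → u < i → f u ≡ g u)
node-injective f g {i} {j} eq
  with refl ← trans (sym (depth-node f i)) (trans (cong depth eq) (depth-node g j))
  = refl , agree i eq
  where
  agree : ∀ t → node f t ≡ node g t → ∀ u → u < t → f u ≡ g u
  agree (suc t) eq u u<1+t with child-injective {d = f t} {d′ = g t} eq | m≤n⇒m<n∨m≡n (s≤s⁻¹ u<1+t)
  ... | nodes≡ , _ | inj₁ u<t = agree t nodes≡ u u<t
  ... | _ , f≡g | inj₂ refl = f≡g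

node-cong : ∀ f g t → (∀ u → u < t → f u ≡ g u) → node f t ≡ node g t
node-cong f g zero _ = refl
node-cong f g (suc t) agree =
  cong₂ child (node-cong f g t (λ u u<t → agree u (m<n⇒m<1+n u<t))) (agree t ≤-refl)

node-bound : ∀ f t → 2 + node f t ≤ 2 ^ suc t
node-bound f zero = ≤-refl
node-bound f (suc t) = ≤-trans (2+child≤ (node f t) (f t)) (*-monoʳ-≤ 2 (node-bound f t))
  where
  2+child≤ : ∀ x d → 2 + child x d ≤ 2 * (2 + x)
  2+child≤ x zero = subst (2 + child x zero ≤_) (rearrange x) (n≤1+n _)
    where
    rearrange : ∀ x → 1 + (2 + (2 * x + 1)) ≡ 2 * (2 + x)
    rearrange = solve-∀
  2+child≤ x (suc zero) = ≤-reflexive (rearrange x)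
    where
    rearrange : ∀ x → 2 + (2 * x + 2) ≡ 2 * (2 + x)
    rearrange = solve-∀

toℕ-mod : ∀ {x m} .{{_ : NonZero m}} → x < m → toℕ (x mod m) ≡ x
toℕ-mod x<m = trans (toℕ-fromℕ< _) (m<n⇒m%n≡m x<m)

Child⇒child : ∀ {m} {i j : Fin m} → Child i j → ∃[ d ] toℕ j ≡ child (toℕ i) d
Child⇒child (inj₁ eq) = zero , eq
Child⇒child (inj₂ eq) = suc zero , eq

child⇒Child : ∀ {m} {i j : Fin m} d → toℕ j ≡ child (toℕ i) d → Child i j
child⇒Child zero eq = inj₁ eq
child⇒Child (suc zero) eq = inj₂ eq

depth-Child : ∀ {m} {i j : Fin m} → Child i j → depth (toℕ j) ≡ suc (depth (toℕ i))
depth-Child {i = i} {j} ij with d , eq ← Child⇒child {i = i} {j} ij =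
  trans (cong depth eq) (depth-child (toℕ i) d)

Child-parent-unique : ∀ {m} {i i′ j : Fin m} → Child i j → Child i′ j → i ≡ i′
Child-parent-unique {i = i} {i′} {j} ij i′j
  with d , eq ← Child⇒child {i = i} {j} ij | d′ , eq′ ← Child⇒child {i = i′} {j} i′j =
  toℕ-injective (proj₁ (child-injective {d = d} {d′ = d′} (trans (sym eq) eq′)))

module _ (h : ℕ) where

  depth<h+1 : (v : Fin (n (T h))) → depth (toℕ v) < h + 1
  depth<h+1 v = subst (depth (toℕ v) <_) (+-comm 1 h)
    (s≤s (n<2^[1+m]⇒⌊log₂n⌋≤m h (subst (suc (toℕ v) <_) (cong (2 ^_) (+-comm h 1)) 1+v<2^[h+1])))
    where
    1+v<2^[h+1] : suc (toℕ v) < 2 ^ (h + 1)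
    1+v<2^[h+1] = ≤-trans (s≤s (toℕ<n v)) (≤-reflexive (m+[n∸m]≡n (m^n>0 2 (h + 1))))

  depthColouring : Fin (n (T h)) → Fin (h + 1)
  depthColouring v = fromℕ< (depth<h+1 v)

  depthColouring-anagramFree : AnagramFree (T h) depthColouring
  depthColouring-anagramFree =
    levelColouring-anagramFree Child depthColouring
      (λ {x} {y} → level-Child {x} {y}) (λ {x} {x′} {y} → Child-parent-unique {i = x} {x′} {y})
    where
    level-Child : ∀ {i j : Fin (n (T h))} → Child i j → toℕ (depthColouring j) ≡ suc (toℕ (depthColouring i))
    level-Child {i} {j} ij = trans (toℕ-fromℕ< (depth<h+1 j))
      (trans (depth-Child {i = i} {j} ij) (cong suc (sym (toℕ-fromℕ< (depth<h+1 i)))))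

  node<n : ∀ f {t} → t ≤ h → node f t < n (T h)
  node<n f {t} t≤h = ∸-monoˡ-≤ 1 (≤-trans (node-bound f t)
    (subst (2 ^ suc t ≤_) (cong (2 ^_) (+-comm 1 h)) (^-monoʳ-≤ 2 (s≤s t≤h))))

  private instance
    nonEmpty : NonZero (n (T h))
    nonEmpty = >-nonZero (node<n (λ _ → zero) z≤n)

  -- Heap indices beyond the tree wrap around; only nodes of depth at most h are ever converted.
  vertex : ℕ → Fin (n (T h))
  vertex x = x mod n (T h)

  branch : (ℕ → Fin 2) → ℕ → Fin (n (T h))
  branch f t = vertex (node f t)

  toℕ-branch : ∀ f {t} → t ≤ h → toℕ (branch f t) ≡ node f t
  toℕ-branch f t≤h = toℕ-mod (node<n f t≤h)

  branch-cong : ∀ {f g} t → (∀ u → u < t → f u ≡ g u) → branch f t ≡ branch g t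
  branch-cong {f} {g} t agree = cong vertex (node-cong f g t agree)

  branch-Child : ∀ f {t t′} → t′ ≡ suc t → t′ ≤ h → Child (branch f t) (branch f t′)
  branch-Child f {t} refl t′≤h = child⇒Child (f t) (begin
    toℕ (branch f (suc t))         ≡⟨ toℕ-branch f t′≤h ⟩
    child (node f t) (f t)         ≡⟨ cong (λ x → child x (f t)) (toℕ-branch f (<⇒≤ t′≤h)) ⟨
    child (toℕ (branch f t)) (f t) ∎)
    where open ≡-Reasoning

  branch-injective : ∀ f g {i j} → i ≤ h → j ≤ h → branch f i ≡ branch g j →
    i ≡ j × (∀ u → u < i → f u ≡ g u)
  branch-injective f g i≤h j≤h eq =
    node-injective f g (trans (sym (toℕ-branch f i≤h)) (trans (cong toℕ eq) (toℕ-branch g j≤h)))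

  forkPath : (f g : ℕ → Fin 2) → ℕ → ℕ → List (Fin (n (T h)))
  forkPath f g e L = applyDownFrom (λ i → branch f (suc e + i)) L ++ applyUpTo (λ i → branch g (e + i)) L

  forkPath-isPath : ∀ {f g e} l → e + suc l ≤ h → (∀ i → i < e → f i ≡ g i) → f e ≢ g e →
    IsPath (T h) (forkPath f g e (suc l))
  forkPath-isPath {f} {g} {e} l e+1+l≤h agree fe≢ge =
    Walk-applyDownFrom-++ (T h) climb l climb-adj
      (junction , Walk-applyUpTo (T h) descent (suc l) descent-adj) ,
    ++⁺ (applyDownFrom⁺₁ climb (suc l) climb-distinct) (applyUpTo⁺₁ descent (suc l) descent-distinct) disjoint
    where
    climb descent : ℕ → Fin (n (T h))
    climb i = branch f (suc e + i)
    descent i = branch g (e + i)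
    1+e+i≤h : ∀ {i} → i ≤ l → suc (e + i) ≤ h
    1+e+i≤h {i} i≤l = ≤-trans (≤-reflexive (sym (+-suc e i))) (≤-trans (+-monoʳ-≤ e (s≤s i≤l)) e+1+l≤h)
    e+i≤h : ∀ {i} → i ≤ l → e + i ≤ h
    e+i≤h i≤l = ≤-trans (n≤1+n _) (1+e+i≤h i≤l)
    climb-adj : ∀ i → i < l → Adj (T h) (climb (suc i)) (climb i)
    climb-adj i i<l = inj₂ (branch-Child f (cong suc (+-suc e i)) (1+e+i≤h i<l))
    descent-adj : ∀ i → suc i < suc l → Adj (T h) (descent i) (descent (suc i))
    descent-adj i (s≤s i<l) = inj₁ (branch-Child g (+-suc e i) (e+i≤h i<l))
    junction : Adj (T h) (climb 0) (descent 0)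
    junction = inj₂ (subst (λ v → Child v (climb 0)) (branch-cong (e + 0) agree′)
                           (branch-Child f refl (1+e+i≤h z≤n)))
      where
      agree′ : ∀ u → u < e + 0 → f u ≡ g u
      agree′ u u<e+0 = agree u (subst (u <_) (+-identityʳ e) u<e+0)
    climb-distinct : ∀ {i j} → j < i → i < suc l → climb i ≢ climb j
    climb-distinct {i} {j} j<i (s≤s i≤l) eq = <⇒≢ j<i (sym (+-cancelˡ-≡ (suc e) i j
      (proj₁ (branch-injective f f (1+e+i≤h i≤l) (1+e+i≤h (<⇒≤ (<-≤-trans j<i i≤l))) eq))))
    descent-distinct : ∀ {i j} → i < j → j < suc l → descent i ≢ descent j
    descent-distinct {i} {j} i<j (s≤s j≤l) eq = <⇒≢ i<j (+-cancelˡ-≡ e i j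
      (proj₁ (branch-injective g g (e+i≤h (<⇒≤ (<-≤-trans i<j j≤l))) (e+i≤h j≤l) eq)))
    disjoint : ∀ {v} → ¬ (v ∈ applyDownFrom climb (suc l) × v ∈ applyUpTo descent (suc l))
    disjoint (v∈climb , v∈descent)
      with i , s≤s i≤l , refl ← ∈-applyDownFrom⁻ climb v∈climb
         | j , s≤s j≤l , v≡descent ← ∈-applyUpTo⁻ descent v∈descent =
      fe≢ge (proj₂ (branch-injective f g (1+e+i≤h i≤l) (e+i≤h j≤l) v≡descent) e (s≤s (m≤m+n e i)))

-- Signatures of branches

greatest : ∀ {P : ℕ → Set} → Decidable P → ℕ → Maybe ℕ
greatest P? zero with P? zero
... | yes _ = just zero
... | no _ = nothing
greatest P? (suc t) with P? (suc t)
... | yes _ = just (suc t)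
... | no _ = greatest P? t

greatest-spec : ∀ {P : ℕ → Set} (P? : Decidable P) {e} t → e ≤ t → P e →
  ∃[ s ] (greatest P? t ≡ just s × e ≤ s × s ≤ t × P s)
greatest-spec P? zero z≤n Pe with P? zero
... | yes P0 = zero , refl , z≤n , z≤n , P0
... | no ¬P0 = contradiction Pe ¬P0
greatest-spec P? {e} (suc t) e≤1+t Pe with P? (suc t)
... | yes P[1+t] = suc t , refl , e≤1+t , ≤-refl , P[1+t]
... | no ¬P[1+t]
  with s , eq , e≤s , s≤t , Ps ← greatest-spec P? t (s≤s⁻¹ (≤∧≢⇒< e≤1+t λ { refl → ¬P[1+t] Pe })) Pe
  = s , eq , e≤s , m≤n⇒m≤1+n s≤t , Ps

funToFin-injective : ∀ {m k} {F G : Fin m → Fin k} → funToFin F ≡ funToFin G → ∀ x → F x ≡ G x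
funToFin-injective {F = F} {G} eq x =
  trans (sym (finToFun-funToFin F x)) (trans (cong (λ y → finToFun y x) eq) (finToFun-funToFin G x))

funToFin-cong : ∀ {m k} {F G : Fin m → Fin k} → (∀ x → F x ≡ G x) → funToFin F ≡ funToFin G
funToFin-cong {zero} _ = refl
funToFin-cong {suc m} F≗G = cong₂ combine (F≗G zero) (funToFin-cong (λ x → F≗G (suc x)))

leafBranch : ∀ h → Fin (2 ^ h) → ℕ → Fin 2
leafBranch h leaf i with i <? h
... | yes i<h = finToFun leaf (fromℕ< i<h)
... | no _ = zero

leafBranch-toℕ : ∀ h (leaf : Fin (2 ^ h)) (y : Fin h) → leafBranch h leaf (toℕ y) ≡ finToFun leaf y
leafBranch-toℕ h leaf y with toℕ y <? h
... | yes y<h = cong (finToFun leaf) (fromℕ<-toℕ y y<h)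
... | no y≮h = contradiction (toℕ<n y) y≮h

countRange : ℕ → ℕ
countRange h = suc ⌈ h /2⌉

module _ {h k} (c : Fin (n (T h)) → Fin k) (anagramFree : AnagramFree (T h) c) where

  prefix : (ℕ → Fin 2) → ℕ → List (Fin (n (T h)))
  prefix f t = applyUpTo (branch h f) t

  branch-proper : ∀ f {i} → suc i ≤ h → c (branch h f i) ≢ c (branch h f (suc i))
  branch-proper f {i} 1+i≤h =
    anagramFree⇒proper (T h) c anagramFree (inj₁ (branch-Child h f refl 1+i≤h))
      (λ eq → 1+n≢n (sym (proj₁ (branch-injective h f f (<⇒≤ 1+i≤h) 1+i≤h eq))))

  prefixCount<countRange : ∀ f {t} a → t ≤ h → countColour c a (prefix f t) < countRange h
  prefixCount<countRange f {t} a t≤h = s≤s (≤-trans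
    (countColour-alternating c (branch h f) t (λ i 2+i≤t → branch-proper f (≤-trans (<⇒≤ 2+i≤t) t≤h)) a)
    (⌈n/2⌉-mono t≤h))

  repeat⇒prefixColourings-differ : ∀ {f g e} l → e + suc l ≤ h → (∀ i → i < e → f i ≡ g i) → f e ≢ g e →
    c (branch h f (e + suc l)) ≡ c (branch h f e) →
    ¬ SameColouring c (prefix f (e + suc l)) (prefix g (e + suc l))
  repeat⇒prefixColourings-differ {f} {g} {e} l e+1+l≤h agree fe≢ge repeat same =
    anagramFree (forkPath h f g e (suc l))
      (anagram-++ (T h) c (forkPath-isPath h l e+1+l≤h agree fe≢ge) halves-length (s≤s z≤n)
        (sameColouring-fork c (branch h f) (branch h g) e (suc l)
          (λ i i<e → branch-cong h i (λ u u<i → agree u (<-trans u<i i<e))) repeat same))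
    where
    halves-length = trans (length-applyDownFrom (λ i → branch h f (suc e + i)) (suc l))
                          (sym (length-applyUpTo (λ i → branch h g (e + i)) (suc l)))

  hasColour? : (f : ℕ → Fin 2) (a : Fin k) → Decidable (λ t → c (branch h f t) ≡ a)
  hasColour? f a t = c (branch h f t) ≟ a

  -- The record of colour a: nothing if a misses the branch, otherwise the direction taken at the
  -- deepest vertex of colour a and the colour counts above it.
  encode : (ℕ → Fin 2) → Maybe ℕ → Fin (suc (2 * countRange h ^ k))
  encode f nothing = zero
  encode f (just s) = suc (combine (f s) (funToFin (λ b → countColour c b (prefix f s) mod countRange h)))

  signature : (ℕ → Fin 2) → Fin k → Fin (suc (2 * countRange h ^ k))
  signature f a = encode f (greatest (hasColour? f a) h)

  encode-just-injective : ∀ {f g s s′} → s ≤ h → s′ ≤ h → encode f (just s) ≡ encode g (just s′) →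
    f s ≡ g s′ × SameColouring c (prefix f s) (prefix g s′)
  encode-just-injective {f} {g} {s} {s′} s≤h s′≤h eq
    with f[s]≡g[s′] , counts≡ ← combine-injective (f s) _ (g s′) _ (Fin-suc-injective eq)
    = f[s]≡g[s′] , λ b → begin
      countColour c b (prefix f s)                            ≡⟨ toℕ-mod (prefixCount<countRange f b s≤h) ⟨
      toℕ (countColour c b (prefix f s) mod countRange h)    ≡⟨ cong toℕ (funToFin-injective counts≡ b) ⟩
      toℕ (countColour c b (prefix g s′) mod countRange h)   ≡⟨ toℕ-mod (prefixCount<countRange g b s′≤h) ⟩
      countColour c b (prefix g s′)                           ∎
    where open ≡-Reasoning

  signature-separates : ∀ {f g e} → e < h → (∀ i → i < e → f i ≡ g i) → f e ≢ g e →
    ¬ (∀ a → signature f a ≡ signature g a)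
  signature-separates {f} {g} {e} e<h agree fe≢ge same
    with s , deepest-f , e≤s , s≤h , c[s]≡c[e] ← greatest-spec (hasColour? f (c (branch h f e))) h (<⇒≤ e<h) refl
       | s′ , deepest-g , _ , s′≤h , _ ← greatest-spec (hasColour? g (c (branch h f e))) h (<⇒≤ e<h)
                                                      (cong c (sym (branch-cong h e agree)))
    with f[s]≡g[s′] , sameCounts ← encode-just-injective {f} {g} s≤h s′≤h
           (trans (sym (cong (encode f) deepest-f)) (trans (same (c (branch h f e))) (cong (encode g) deepest-g)))
    with refl ← trans (sym (length-applyUpTo (branch h f) s))
                      (trans (sameColouring⇒≡length c {prefix f s} {prefix g s′} sameCounts)
                             (length-applyUpTo (branch h g) s′))
    with m≤n⇒∃[o]m+o≡n e≤s
  ... | zero , refl = fe≢ge (subst (λ t → f t ≡ g t) (+-identityʳ e) f[s]≡g[s′])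
  ... | suc l , refl = repeat⇒prefixColourings-differ l s≤h agree fe≢ge c[s]≡c[e] sameCounts

  signature-determines-branch : ∀ {f g} → (∀ a → signature f a ≡ signature g a) →
    ∀ e → e ≤ h → ∀ i → i < e → f i ≡ g i
  signature-determines-branch same zero _ _ ()
  signature-determines-branch {f} {g} same (suc e) 1+e≤h i i<1+e
    with signature-determines-branch same e (<⇒≤ 1+e≤h) | m≤n⇒m<n∨m≡n (s≤s⁻¹ i<1+e)
  ... | below | inj₁ i<e = below i i<e
  ... | below | inj₂ refl = decidable-stable (f i ≟ g i) (λ fi≢gi → signature-separates 1+e≤h below fi≢gi same)

  leaves≤signatures : 2 ^ h ≤ suc (2 * countRange h ^ k) ^ k
  leaves≤signatures = injective⇒≤ code-injective
    where
    code : Fin (2 ^ h) → Fin (suc (2 * countRange h ^ k) ^ k)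
    code leaf = funToFin (signature (leafBranch h leaf))
    code-injective : ∀ {x y} → code x ≡ code y → x ≡ y
    code-injective {x} {y} eq = begin
      x                             ≡⟨ funToFin-finToFin {h} {2} x ⟨
      funToFin (finToFun {2} {h} x) ≡⟨ funToFin-cong leaves-agree ⟩
      funToFin (finToFun {2} {h} y) ≡⟨ funToFin-finToFin {h} {2} y ⟩
      y                             ∎
      where
      open ≡-Reasoning
      agree = signature-determines-branch (funToFin-injective eq) h ≤-refl
      leaves-agree : ∀ i → finToFun x i ≡ finToFun y i
      leaves-agree i = trans (sym (leafBranch-toℕ h x i)) (trans (agree (toℕ i) (toℕ<n i)) (leafBranch-toℕ h y i))

-- Counting signatures

⌈n/2⌉+⌈n/2⌉≤1+n : ∀ n → ⌈ n /2⌉ + ⌈ n /2⌉ ≤ suc n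
⌈n/2⌉+⌈n/2⌉≤1+n n =
  ≤-trans (+-monoʳ-≤ ⌈ n /2⌉ (⌊n/2⌋≤⌈n/2⌉ (suc n))) (≤-reflexive (⌊n/2⌋+⌈n/2⌉≡n (suc n)))

scaled-^-mono : ∀ q {a b p} → q * a ^ p ≤ b ^ p → a ≤ b → ∀ d → q * a ^ (d + p) ≤ b ^ (d + p)
scaled-^-mono q base a≤b zero = base
scaled-^-mono q {a} {b} {p} base a≤b (suc d) = begin
  q * (a * a ^ (d + p)) ≡⟨ *-left-comm q a _ ⟩
  a * (q * a ^ (d + p)) ≤⟨ *-mono-≤ a≤b (scaled-^-mono q base a≤b d) ⟩
  b * b ^ (d + p)       ∎
  where open ≤-Reasoning

cube-bound : ∀ h → 10 ≤ h → 3 * countRange h ^ 3 ≤ h ^ 3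
cube-bound h 10≤h with x , refl ← m≤n⇒∃[o]m+o≡n 10≤h = *-cancelˡ-≤ 8 (begin
  8 * (3 * suc a ^ 3)                                                    ≡⟨ doubling a ⟩
  3 * (2 + (a + a)) ^ 3                                                  ≤⟨ *-monoʳ-≤ 3 (^-monoˡ-≤ 3 2+a+a≤13+x) ⟩
  3 * (13 + x) ^ 3                                                       ≤⟨ m≤m+n _ _ ⟩
  3 * (13 + x) ^ 3 + (1409 + 879 * x + 123 * (x * x) + 5 * (x * x * x)) ≡⟨ cubic x ⟩
  8 * (10 + x) ^ 3                                                       ∎)
  where
  open ≤-Reasoning
  a = ⌈ 10 + x /2⌉
  2+a+a≤13+x : 2 + (a + a) ≤ 13 + x
  2+a+a≤13+x = +-monoʳ-≤ 2 (⌈n/2⌉+⌈n/2⌉≤1+n (10 + x))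
  doubling : ∀ a → 8 * (3 * ((1 + a) * ((1 + a) * ((1 + a) * 1))))
                 ≡ 3 * ((2 + (a + a)) * ((2 + (a + a)) * ((2 + (a + a)) * 1)))
  doubling = solve-∀
  cubic : ∀ x → 3 * ((13 + x) * ((13 + x) * ((13 + x) * 1))) + (1409 + 879 * x + 123 * (x * x) + 5 * (x * x * x))
              ≡ 8 * ((10 + x) * ((10 + x) * ((10 + x) * 1)))
  cubic = solve-∀

signatureCount≤h^k : ∀ {h k} → 10 ≤ h → 3 ≤ k → suc (2 * countRange h ^ k) ≤ h ^ k
signatureCount≤h^k {h} {k} 10≤h 3≤k = begin
  suc (2 * r ^ k)     ≤⟨ +-monoˡ-≤ (2 * r ^ k) (m^n>0 r k) ⟩
  3 * r ^ k           ≡⟨ cong (λ j → 3 * r ^ j) (m∸n+n≡m 3≤k) ⟨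
  3 * r ^ (k ∸ 3 + 3) ≤⟨ scaled-^-mono 3 (cube-bound h 10≤h) r≤h (k ∸ 3) ⟩
  h ^ (k ∸ 3 + 3)     ≡⟨ cong (h ^_) (m∸n+n≡m 3≤k) ⟩
  h ^ k               ∎
  where
  open ≤-Reasoning
  r = countRange h
  r≤h : r ≤ h
  r≤h with x , refl ← m≤n⇒∃[o]m+o≡n 10≤h = ⌈n/2⌉<n (8 + x)

lowerBound : ∀ h → 2 ≤ h → (k : ℕ) (c : Fin (n (T h)) → Fin k) → AnagramFree (T h) c → 2 ^ h ≤ h ^ (k * k)
lowerBound h 2≤h k c anagramFree with h ≤? k * k
... | yes h≤k² = ≤-trans (^-monoʳ-≤ 2 h≤k²) (^-monoˡ-≤ (k * k) 2≤h)
... | no h≰k² = begin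
  2 ^ h                          ≤⟨ leaves≤signatures c anagramFree ⟩
  suc (2 * countRange h ^ k) ^ k ≤⟨ ^-monoˡ-≤ k (signatureCount≤h^k 10≤h 3≤k) ⟩
  (h ^ k) ^ k                    ≡⟨ ^-*-assoc h k k ⟩
  h ^ (k * k)                    ∎
  where
  open ≤-Reasoning
  3≤k : 3 ≤ k
  3≤k = anagramFree⇒3≤colours (T h) c anagramFree
    (forkPath-isPath h {f = λ _ → zero} {g = λ _ → suc zero} {e = 0} 1 2≤h (λ _ ()) λ ())
  10≤h : 10 ≤ h
  10≤h = ≤-<-trans (*-mono-≤ 3≤k 3≤k) (≰⇒> h≰k²)

proposition1 : (h : ℕ) →
    (2 ≤ h → (k : ℕ) → (c : Fin (n (T h)) → Fin k) → AnagramFree (T h) c →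
      2 ^ h ≤ h ^ (k * k))
    × Σ (Fin (n (T h)) → Fin (h + 1)) (λ c → AnagramFree (T h) c)
proposition1 h = lowerBound h , depthColouring h , depthColouring-anagramFree h
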